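{- Let $G$ be a simple connected graph with $m\ge1$ edges and let $v\in V(G)$. Let $G^*$ be the graph obtained from $G$ by attaching three new pendant vertices $a,b,c$ to $v$ and then adding the edges $\{a,b\}$, $\{b,c\}$ and $\{a,c\}$ (so that $\{v,a,b,c\}$ induces $K_4$). Then $$\mathscr{K}(G^*)=\frac{2m\mathscr{K}(G)+12\mu(G,v)+9m+27}{2m+12}.$$
   Context: For a connected graph $H$, effective resistance $r_H(i,j)=(e_i-e_j)^TL^\dagger(e_i-e_j)$ with $L^\dagger$ the Moore–Penrose pseudoinverse of the Laplacian. For connected $H$ with $m\ge1$ edges and degrees $d_i$, Kemeny's constant $\mathscr{K}(H)=\sum_j\pi_jm_{ij}$ for the simple random walk ($\pi_j=d_j/2m$, $m_{ij}$ expected hitting time, $m_{jj}=0$), equal to $\frac1{4m}\sum_{i,j}d_id_jr_H(i,j)$. Moment: $\mu(H,v)=\sum_{i\in V(H)}d_ir_H(i,v)$. -}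

module Defs where

open import Data.Bool using (Bool; true; false; if_then_else_; _∧_)
open import Data.Nat as ℕ using (ℕ; zero; suc)
open import Data.Fin as Fin using (Fin; zero; suc; _<?_)
open import Data.Integer using (+_)
open import Data.Rational using (ℚ; 0ℚ; _+_; _*_; _-_; -_; _/_)
open import Data.Product using (_×_)
open import Relation.Nullary using (¬_; does)
open import Relation.Binary.PropositionalEquality using (_≡_)

Adj : ℕ → Set
Adj n = Fin n → Fin n → Bool

IsSimple : ∀ {n} → Adj n → Set
IsSimple {n} A = (∀ (i j : Fin n) → A i j ≡ A j i) × (∀ (i : Fin n) → A i i ≡ false)

data Reach {n} (A : Adj n) : Fin n → Fin n → Set where
  here : ∀ {i} → Reach A i i
  step : ∀ {i j k} → A i j ≡ true → Reach A j k → Reach A i k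

Connected : ∀ {n} → Adj n → Set
Connected {n} A = ∀ (i j : Fin n) → Reach A i j

Σℕ : ∀ n → (Fin n → ℕ) → ℕ
Σℕ zero f = 0
Σℕ (suc n) f = f zero ℕ.+ Σℕ n (λ i → f (suc i))

Σℚ : ∀ n → (Fin n → ℚ) → ℚ
Σℚ zero f = 0ℚ
Σℚ (suc n) f = f zero + Σℚ n (λ i → f (suc i))

b2n : Bool → ℕ
b2n true = 1
b2n false = 0

deg : ∀ {n} → Adj n → Fin n → ℕ
deg {n} A i = Σℕ n (λ j → b2n (A i j))

edges : ∀ {n} → Adj n → ℕ
edges {n} A = Σℕ n (λ i → Σℕ n (λ j → b2n (does (i <? j) ∧ A i j)))

ℕ→ℚ : ℕ → ℚ
ℕ→ℚ k = + k / 1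

-- reciprocal of a natural number (with 1/0 := 0, never used below)
recipℕ : ℕ → ℚ
recipℕ zero = 0ℚ
recipℕ (suc k) = + 1 / suc k

Matrix : ℕ → Set
Matrix n = Fin n → Fin n → ℚ

_·_ : ∀ {n} → Matrix n → Matrix n → Matrix n
_·_ {n} M N i j = Σℚ n (λ k → M i k * N k j)

laplacian : ∀ {n} → Adj n → Matrix n
laplacian A i j with does (i Fin.≟ j)
... | true = ℕ→ℚ (deg A i)
... | false = if A i j then - ℕ→ℚ 1 else 0ℚ

-- X is the Moore–Penrose pseudoinverse of M (Penrose equations; over ℚ the
-- conjugate transpose is the transpose).  It exists and is unique.
IsMPInverse : ∀ {n} → Matrix n → Matrix n → Set
IsMPInverse {n} M X =
  (∀ i j → (M · (X · M)) i j ≡ M i j) ×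
  (∀ i j → (X · (M · X)) i j ≡ X i j) ×
  (∀ i j → (M · X) i j ≡ (M · X) j i) ×
  (∀ i j → (X · M) i j ≡ (X · M) j i)

-- effective resistance computed from the pseudoinverse X of the Laplacian:
-- (e_i - e_j)^T X (e_i - e_j)
resistance : ∀ {n} → Matrix n → Fin n → Fin n → ℚ
resistance X i j = ((X i i + X j j) - X i j) - X j i

kemeny : ∀ {n} → Adj n → Matrix n → ℚ
kemeny {n} A X =
  recipℕ (4 ℕ.* edges A) *
    Σℚ n (λ i → Σℚ n (λ j → (ℕ→ℚ (deg A i) * ℕ→ℚ (deg A j)) * resistance X i j))

moment : ∀ {n} → Adj n → Matrix n → Fin n → ℚ
moment {n} A X v = Σℚ n (λ i → ℕ→ℚ (deg A i) * resistance X i v)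

-- G* : vertices 0,1,2 are the new vertices a,b,c; old vertex i is suc (suc (suc i)).
-- a,b,c are each joined to v and to each other ({v,a,b,c} induces K4).
isV : ∀ {n} → Fin n → Fin n → Bool
isV v i = does (i Fin.≟ v)

attachK4 : ∀ {n} → Adj n → Fin n → Adj (suc (suc (suc n)))
attachK4 A v (suc (suc (suc i))) (suc (suc (suc j))) = A i j
attachK4 A v (suc (suc (suc i))) _ = isV v i
attachK4 A v _ (suc (suc (suc j))) = isV v j
attachK4 A v zero zero = false
attachK4 A v zero _ = true
attachK4 A v (suc zero) (suc zero) = false
attachK4 A v (suc zero) _ = true
attachK4 A v (suc (suc zero)) (suc (suc zero)) = false
attachK4 A v (suc (suc zero)) _ = true

-- Effective resistances are differences of potentials: if L u = eᵢ - eⱼ then r(i,j) = uᵢ - uⱼ.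
-- This needs only the Penrose equations and the fact that harmonic functions on a connected
-- graph are constant (maximum principle), which makes L X the identity on vectors of sum zero.
-- Potentials on G* are obtained from those on G by placing the three new vertices at fixed
-- offsets from v; hence r* agrees with r on old pairs, equals r(j,v) + ½ between a new vertex
-- and an old vertex j, and equals ½ between two new vertices. With the degrees d_k + 3[k = v]
-- and 3, the handshake lemma Σ d = 2m and r(v,v) = 0, the sum Σ d*ᵢ d*ⱼ r*ᵢⱼ becomes
-- Σ dᵢ dⱼ rᵢⱼ + 24 μ(G,v) + 18m + 54, which is then divided by 4(m + 6).

{-# OPTIONS --safe #-}
module Submission where

open import Defs
open import Data.Nat using (ℕ; suc; _≤_)
open import Data.Fin using (Fin)
open import Data.Rational using (_+_; _*_)
open import Relation.Binary.PropositionalEquality using (_≡_)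

open import Algebra.Bundles using (Ring)
import Algebra.Properties.CommutativeMonoid.Sum
import Algebra.Properties.Group
import Algebra.Properties.Semiring.Sum
open import Data.Bool using (true; false; _∧_)
open import Data.Fin using (zero; suc)
import Data.Fin as Fin
import Data.Fin.Properties as FinP
open import Data.Integer using (+_)
import Data.Integer as ℤ
import Data.Integer.Properties as ℤP
open import Data.Maybe using (just; nothing)
open import Data.Nat using (zero; NonZero)
import Data.Nat as ℕ
import Data.Nat.Coprimality as Coprimality
import Data.Nat.Properties as ℕP
open import Data.Product using (Σ-syntax; _,_; proj₁; proj₂)
open import Data.Rational using (ℚ; 0ℚ; 1ℚ; ½; _-_; -_; _/_; mkℚ) renaming (_≤_ to _≤ℚ_)
import Data.Rational.Properties as ℚP
open import Data.Sum using (inj₁; inj₂)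
open import Function using (_∘_)
open import Level using (0ℓ)
open import Relation.Binary.Definitions using (tri<; tri≈; tri>)
open import Relation.Binary.PropositionalEquality
  using (refl; sym; trans; cong; cong₂; subst; _≢_; module ≡-Reasoning)
open import Relation.Nullary using (Dec; yes; no; does)
open import Relation.Nullary.Decidable using (dec-true; dec-false)
open import Tactic.RingSolver using (solve-∀)
import Tactic.RingSolver.Core.AlmostCommutativeRing as ACR

module ℚΣ = Algebra.Properties.Semiring.Sum (Ring.semiring ℚP.+-*-ring)
module ℕΣ = Algebra.Properties.CommutativeMonoid.Sum ℕP.+-0-commutativeMonoid
module ℚGroup = Algebra.Properties.Group ℚP.+-0-group

open ≡-Reasoning

ℚ-ring : ACR.AlmostCommutativeRing 0ℓ 0ℓ
ℚ-ring = ACR.fromCommutativeRing ℚP.+-*-commutativeRing 0≟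
  where
  0≟ : ∀ x → _
  0≟ x with 0ℚ ℚP.≟ x
  ... | yes 0≡x = just 0≡x
  ... | no _    = nothing

ℕ→ℚ≡mkℚ : ∀ k → ℕ→ℚ k ≡ mkℚ (+ k) 0 (Coprimality.sym (Coprimality.1-coprimeTo k))
ℕ→ℚ≡mkℚ k = ℚP.normalize-coprime _

ℕ→ℚ-+ : ∀ a b → ℕ→ℚ (a ℕ.+ b) ≡ ℕ→ℚ a + ℕ→ℚ b
ℕ→ℚ-+ a b = begin
  + (a ℕ.+ b) / 1                  ≡⟨ cong (_/ 1) (ℤP.pos-+ a b) ⟩
  (+ a ℤ.+ + b) / 1                ≡⟨ cong (_/ 1) (sym (cong₂ ℤ._+_ (ℤP.*-identityʳ (+ a)) (ℤP.*-identityʳ (+ b)))) ⟩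
  (+ a ℤ.* + 1 ℤ.+ + b ℤ.* + 1) / 1 ≡⟨ sym (cong₂ _+_ (ℕ→ℚ≡mkℚ a) (ℕ→ℚ≡mkℚ b)) ⟩
  ℕ→ℚ a + ℕ→ℚ b                    ∎

ℕ→ℚ-* : ∀ a b → ℕ→ℚ (a ℕ.* b) ≡ ℕ→ℚ a * ℕ→ℚ b
ℕ→ℚ-* a b = trans (cong (_/ 1) (ℤP.pos-* a b)) (sym (cong₂ _*_ (ℕ→ℚ≡mkℚ a) (ℕ→ℚ≡mkℚ b)))

ℕ→ℚ*recipℕ : ∀ k .{{_ : NonZero k}} → ℕ→ℚ k * recipℕ k ≡ 1ℚ
ℕ→ℚ*recipℕ (suc k) = trans
  (cong₂ _*_ (ℕ→ℚ≡mkℚ (suc k)) (ℚP.normalize-coprime (Coprimality.1-coprimeTo (suc k))))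
  (ℚP.*-inverseʳ (mkℚ (+ suc k) 0 (Coprimality.sym (Coprimality.1-coprimeTo (suc k)))))

Σℚ≡sum : ∀ n (f : Fin n → ℚ) → Σℚ n f ≡ ℚΣ.sum f
Σℚ≡sum zero    f = refl
Σℚ≡sum (suc n) f = cong (_+_ (f zero)) (Σℚ≡sum n (λ i → f (suc i)))

Σℕ≡sum : ∀ n (f : Fin n → ℕ) → Σℕ n f ≡ ℕΣ.sum f
Σℕ≡sum zero    f = refl
Σℕ≡sum (suc n) f = cong (f zero ℕ.+_) (Σℕ≡sum n (λ i → f (suc i)))

Σℚ-cong : ∀ {n} {f g : Fin n → ℚ} → (∀ i → f i ≡ g i) → Σℚ n f ≡ Σℚ n g
Σℚ-cong {n} {f} {g} f≗g = begin
  Σℚ n f      ≡⟨ Σℚ≡sum n f ⟩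
  ℚΣ.sum f    ≡⟨ ℚΣ.sum-cong-≗ f≗g ⟩
  ℚΣ.sum g    ≡⟨ Σℚ≡sum n g ⟨
  Σℚ n g      ∎

Σℚ-distrib-+ : ∀ {n} (f g : Fin n → ℚ) → Σℚ n (λ i → f i + g i) ≡ Σℚ n f + Σℚ n g
Σℚ-distrib-+ {n} f g = begin
  Σℚ n (λ i → f i + g i)   ≡⟨ Σℚ≡sum n _ ⟩
  ℚΣ.sum (λ i → f i + g i) ≡⟨ ℚΣ.∑-distrib-+ f g ⟩
  ℚΣ.sum f + ℚΣ.sum g      ≡⟨ cong₂ _+_ (Σℚ≡sum n f) (Σℚ≡sum n g) ⟨
  Σℚ n f + Σℚ n g          ∎

Σℚ-*ˡ : ∀ {n} c (f : Fin n → ℚ) → Σℚ n (λ i → c * f i) ≡ c * Σℚ n f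
Σℚ-*ˡ {n} c f = begin
  Σℚ n (λ i → c * f i)   ≡⟨ Σℚ≡sum n _ ⟩
  ℚΣ.sum (λ i → c * f i) ≡⟨ ℚΣ.*-distribˡ-sum c f ⟨
  c * ℚΣ.sum f           ≡⟨ cong (c *_) (Σℚ≡sum n f) ⟨
  c * Σℚ n f             ∎

Σℚ-neg : ∀ {n} (f : Fin n → ℚ) → Σℚ n (λ i → - f i) ≡ - Σℚ n f
Σℚ-neg {n} f = begin
  Σℚ n (λ i → - f i)          ≡⟨ Σℚ-cong (λ i → neg≡-1* (f i)) ⟩
  Σℚ n (λ i → - 1ℚ * f i)     ≡⟨ Σℚ-*ˡ (- 1ℚ) f ⟩
  - 1ℚ * Σℚ n f               ≡⟨ neg≡-1* (Σℚ n f) ⟨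
  - Σℚ n f                    ∎
  where
  neg≡-1* : ∀ x → - x ≡ - 1ℚ * x
  neg≡-1* = solve-∀ ℚ-ring

Σℚ-distrib-- : ∀ {n} (f g : Fin n → ℚ) → Σℚ n (λ i → f i - g i) ≡ Σℚ n f - Σℚ n g
Σℚ-distrib-- {n} f g = trans (Σℚ-distrib-+ f (λ i → - g i)) (cong (_+_ (Σℚ n f)) (Σℚ-neg g))

Σℚ-comm : ∀ {n m} (f : Fin n → Fin m → ℚ) →
          Σℚ n (λ i → Σℚ m (f i)) ≡ Σℚ m (λ j → Σℚ n (λ i → f i j))
Σℚ-comm {n} {m} f = begin
  Σℚ n (λ i → Σℚ m (f i))                  ≡⟨ Σℚ-cong (λ i → Σℚ≡sum m (f i)) ⟩
  Σℚ n (λ i → ℚΣ.sum (f i))                ≡⟨ Σℚ≡sum n _ ⟩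
  ℚΣ.sum (λ i → ℚΣ.sum (f i))              ≡⟨ ℚΣ.∑-comm f ⟩
  ℚΣ.sum (λ j → ℚΣ.sum (λ i → f i j))      ≡⟨ Σℚ≡sum m _ ⟨
  Σℚ m (λ j → ℚΣ.sum (λ i → f i j))        ≡⟨ Σℚ-cong (λ j → Σℚ≡sum n (λ i → f i j)) ⟨
  Σℚ m (λ j → Σℚ n (λ i → f i j))          ∎

Σℕ→ℚ : ∀ n (f : Fin n → ℕ) → ℕ→ℚ (Σℕ n f) ≡ Σℚ n (λ i → ℕ→ℚ (f i))
Σℕ→ℚ zero    f = refl
Σℕ→ℚ (suc n) f = trans (ℕ→ℚ-+ (f zero) _) (cong (_+_ (ℕ→ℚ (f zero))) (Σℕ→ℚ n (λ i → f (suc i))))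

-- Phrased with isV so that it agrees definitionally with the edges between v and the new vertices.
δ : ∀ {n} → Fin n → Fin n → ℚ
δ i k = ℕ→ℚ (b2n (isV i k))

δ-refl : ∀ {n} (k : Fin n) → δ k k ≡ 1ℚ
δ-refl k rewrite dec-true (k Fin.≟ k) refl = refl

δ-≢ : ∀ {n} {i k : Fin n} → i ≢ k → δ i k ≡ 0ℚ
δ-≢ {i = i} {k} i≢k rewrite dec-false (k Fin.≟ i) (λ k≡i → i≢k (sym k≡i)) = refl

δ-sym : ∀ {n} (i k : Fin n) → δ i k ≡ δ k i
δ-sym i k with i Fin.≟ k
... | yes refl = δ-refl i
... | no i≢k   = δ-≢ i≢k

Σℚ-δ : ∀ {n} (f : Fin n → ℚ) (j : Fin n) → Σℚ n (λ k → δ j k * f k) ≡ f j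
Σℚ-δ {suc n} f zero = begin
  1ℚ * f zero + Σℚ n (λ k → 0ℚ * f (suc k))  ≡⟨ cong (_+_ (1ℚ * f zero)) (Σℚ-*ˡ 0ℚ (λ k → f (suc k))) ⟩
  1ℚ * f zero + 0ℚ * Σℚ n (λ k → f (suc k))  ≡⟨ cancel (f zero) (Σℚ n (λ k → f (suc k))) ⟩
  f zero                                     ∎
  where
  cancel : ∀ a s → 1ℚ * a + 0ℚ * s ≡ a
  cancel = solve-∀ ℚ-ring
Σℚ-δ {suc n} f (suc j) = begin
  0ℚ * f zero + Σℚ n (λ k → δ j k * f (suc k))  ≡⟨ cong (_+_ (0ℚ * f zero)) (Σℚ-δ (λ k → f (suc k)) j) ⟩
  0ℚ * f zero + f (suc j)                       ≡⟨ cancel (f zero) (f (suc j)) ⟩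
  f (suc j)                                     ∎
  where
  cancel : ∀ a b → 0ℚ * a + b ≡ b
  cancel = solve-∀ ℚ-ring

Σℚ-*δ : ∀ {n} (f : Fin n → ℚ) (j : Fin n) → Σℚ n (λ k → f k * δ j k) ≡ f j
Σℚ-*δ f j = trans (Σℚ-cong (λ k → ℚP.*-comm (f k) (δ j k))) (Σℚ-δ f j)

δ-*-difference : ∀ {n} (f : Fin n → ℚ) (i k : Fin n) → δ i k * (f k - f i) ≡ 0ℚ
δ-*-difference f i k with i Fin.≟ k
... | yes refl = trans (cong (δ i i *_) (ℚP.+-inverseʳ (f i))) (ℚP.*-zeroʳ (δ i i))
... | no i≢k   = trans (cong (_* (f k - f i)) (δ-≢ i≢k)) (ℚP.*-zeroˡ (f k - f i))

adjℚ : ∀ {n} → Adj n → Fin n → Fin n → ℚ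
adjℚ A k l = ℕ→ℚ (b2n (A k l))

infixr 7 _·ᵥ_

_·ᵥ_ : ∀ {n} → Matrix n → (Fin n → ℚ) → Fin n → ℚ
_·ᵥ_ {n} M x k = Σℚ n (λ l → M k l * x l)

·ᵥ-distrib-- : ∀ {n} (M : Matrix n) (x y : Fin n → ℚ) k →
               (M ·ᵥ (λ l → x l - y l)) k ≡ (M ·ᵥ x) k - (M ·ᵥ y) k
·ᵥ-distrib-- {n} M x y k = trans (Σℚ-cong (λ l → distrib (M k l) (x l) (y l))) (Σℚ-distrib-- {n} _ _)
  where
  distrib : ∀ a p q → a * (p - q) ≡ a * p - a * q
  distrib = solve-∀ ℚ-ring

module _ {n} {A : Adj n} where

  laplacian-diag : ∀ k → laplacian A k k ≡ ℕ→ℚ (deg A k)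
  laplacian-diag k rewrite dec-true (k Fin.≟ k) refl = refl

  laplacian-offdiag : ∀ {k l} → k ≢ l → laplacian A k l ≡ - adjℚ A k l
  laplacian-offdiag {k} {l} k≢l rewrite dec-false (k Fin.≟ l) k≢l with A k l
  ... | true  = refl
  ... | false = refl

  laplacian-sym : IsSimple A → ∀ k l → laplacian A k l ≡ laplacian A l k
  laplacian-sym (symmetric , _) k l = by-cases (k Fin.≟ l)
    where
    by-cases : Dec (k ≡ l) → laplacian A k l ≡ laplacian A l k
    by-cases (yes refl) = refl
    by-cases (no k≢l)   = begin
      laplacian A k l ≡⟨ laplacian-offdiag k≢l ⟩
      - adjℚ A k l    ≡⟨ cong (λ b → - ℕ→ℚ (b2n b)) (symmetric k l) ⟩
      - adjℚ A l k    ≡⟨ laplacian-offdiag (λ l≡k → k≢l (sym l≡k)) ⟨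
      laplacian A l k ∎

  laplacian-*-entry : IsSimple A → ∀ (x : Fin n → ℚ) k l →
    laplacian A k l * x l ≡ δ k l * (ℕ→ℚ (deg A k) * x k) - adjℚ A k l * x l
  laplacian-*-entry (_ , irreflexive) x k l = by-cases (k Fin.≟ l)
    where
    d = ℕ→ℚ (deg A k)
    diagonal : ∀ a y → a * y ≡ 1ℚ * (a * y) - 0ℚ * y
    diagonal = solve-∀ ℚ-ring
    offdiagonal : ∀ a y c → - a * y ≡ 0ℚ * c - a * y
    offdiagonal = solve-∀ ℚ-ring
    by-cases : Dec (k ≡ l) → laplacian A k l * x l ≡ δ k l * (d * x k) - adjℚ A k l * x l
    by-cases (yes refl) = begin
      laplacian A k k * x k                ≡⟨ cong (_* x k) (laplacian-diag k) ⟩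
      d * x k                              ≡⟨ diagonal d (x k) ⟩
      1ℚ * (d * x k) - 0ℚ * x k
        ≡⟨ cong₂ (λ e a → e * (d * x k) - a * x k) (δ-refl k) (cong (ℕ→ℚ ∘ b2n) (irreflexive k)) ⟨
      δ k k * (d * x k) - adjℚ A k k * x k ∎
    by-cases (no k≢l)   = begin
      laplacian A k l * x l                ≡⟨ cong (_* x l) (laplacian-offdiag k≢l) ⟩
      - adjℚ A k l * x l                   ≡⟨ offdiagonal (adjℚ A k l) (x l) (d * x k) ⟩
      0ℚ * (d * x k) - adjℚ A k l * x l    ≡⟨ cong (λ e → e * (d * x k) - adjℚ A k l * x l) (δ-≢ k≢l) ⟨
      δ k l * (d * x k) - adjℚ A k l * x l ∎

  laplacian-·ᵥ : IsSimple A → ∀ (x : Fin n → ℚ) k →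
    (laplacian A ·ᵥ x) k ≡ Σℚ n (λ l → adjℚ A k l * (x k - x l))
  laplacian-·ᵥ simple x k = begin
    (laplacian A ·ᵥ x) k
      ≡⟨ Σℚ-cong (laplacian-*-entry simple x k) ⟩
    Σℚ n (λ l → δ k l * (ℕ→ℚ (deg A k) * x k) - adjℚ A k l * x l)
      ≡⟨ Σℚ-distrib-- {n} _ _ ⟩
    Σℚ n (λ l → δ k l * (ℕ→ℚ (deg A k) * x k)) - Σℚ n (λ l → adjℚ A k l * x l)
      ≡⟨ cong (_- Σℚ n (λ l → adjℚ A k l * x l)) (Σℚ-δ (λ _ → ℕ→ℚ (deg A k) * x k) k) ⟩
    ℕ→ℚ (deg A k) * x k - Σℚ n (λ l → adjℚ A k l * x l)
      ≡⟨ cong (λ d → d * x k - Σℚ n (λ l → adjℚ A k l * x l)) (Σℕ→ℚ n (λ l → b2n (A k l))) ⟩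
    Σℚ n (adjℚ A k) * x k - Σℚ n (λ l → adjℚ A k l * x l)
      ≡⟨ cong (_- Σℚ n (λ l → adjℚ A k l * x l)) (trans (ℚP.*-comm _ (x k)) (sym (Σℚ-*ˡ (x k) (adjℚ A k)))) ⟩
    Σℚ n (λ l → x k * adjℚ A k l) - Σℚ n (λ l → adjℚ A k l * x l)
      ≡⟨ Σℚ-distrib-- {n} _ _ ⟨
    Σℚ n (λ l → x k * adjℚ A k l - adjℚ A k l * x l)
      ≡⟨ Σℚ-cong (λ l → factor (adjℚ A k l) (x k) (x l)) ⟩
    Σℚ n (λ l → adjℚ A k l * (x k - x l)) ∎
    where
    factor : ∀ a p q → p * a - a * q ≡ a * (p - q)
    factor = solve-∀ ℚ-ring

-- Harmonic functions on connected graphs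

+-nonneg-≡0ˡ : ∀ {a b} → 0ℚ ≤ℚ a → 0ℚ ≤ℚ b → a + b ≡ 0ℚ → a ≡ 0ℚ
+-nonneg-≡0ˡ {a} {b} 0≤a 0≤b a+b≡0 = ℚP.≤-antisym a≤0 0≤a
  where
  a≤0 : a ≤ℚ 0ℚ
  a≤0 = ℚP.≤-trans (ℚP.≤-reflexive (sym (ℚP.+-identityʳ a)))
          (ℚP.≤-trans (ℚP.+-monoʳ-≤ a 0≤b) (ℚP.≤-reflexive a+b≡0))

Σℚ-nonneg : ∀ {n} (f : Fin n → ℚ) → (∀ i → 0ℚ ≤ℚ f i) → 0ℚ ≤ℚ Σℚ n f
Σℚ-nonneg {zero}  f 0≤f = ℚP.≤-refl
Σℚ-nonneg {suc n} f 0≤f = ℚP.+-mono-≤ (0≤f zero) (Σℚ-nonneg (λ i → f (suc i)) (λ i → 0≤f (suc i)))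

Σℚ-nonneg-≡0 : ∀ {n} (f : Fin n → ℚ) → (∀ i → 0ℚ ≤ℚ f i) → Σℚ n f ≡ 0ℚ → ∀ i → f i ≡ 0ℚ
Σℚ-nonneg-≡0 {suc n} f 0≤f Σf≡0 zero    =
  +-nonneg-≡0ˡ (0≤f zero) (Σℚ-nonneg _ (λ i → 0≤f (suc i))) Σf≡0
Σℚ-nonneg-≡0 {suc n} f 0≤f Σf≡0 (suc i) =
  Σℚ-nonneg-≡0 (λ i → f (suc i)) (λ i → 0≤f (suc i))
    (+-nonneg-≡0ˡ (Σℚ-nonneg _ (λ i → 0≤f (suc i))) (0≤f zero)
      (trans (ℚP.+-comm (Σℚ n (λ i → f (suc i))) (f zero)) Σf≡0)) i

p≤q⇒0≤q-p : ∀ {p q} → p ≤ℚ q → 0ℚ ≤ℚ q - p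
p≤q⇒0≤q-p {p} p≤q = ℚP.≤-trans (ℚP.≤-reflexive (sym (ℚP.+-inverseʳ p))) (ℚP.+-monoˡ-≤ (- p) p≤q)

max-attained : ∀ {n} (x : Fin (suc n) → ℚ) → Σ[ k ∈ Fin (suc n) ] (∀ j → x j ≤ℚ x k)
max-attained {zero}  x = zero , λ { zero → ℚP.≤-refl }
max-attained {suc n} x with max-attained (λ i → x (suc i))
... | k , x≤xk with ℚP.≤-total (x zero) (x (suc k))
...   | inj₁ x₀≤xk = suc k , λ { zero → x₀≤xk ; (suc j) → x≤xk j }
...   | inj₂ xk≤x₀ = zero  , λ { zero → ℚP.≤-refl ; (suc j) → ℚP.≤-trans (x≤xk j) xk≤x₀ }

harmonic-at-max : ∀ {n} {A : Adj n} → IsSimple A → ∀ (x : Fin n → ℚ) k →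
  (∀ j → x j ≤ℚ x k) → (laplacian A ·ᵥ x) k ≡ 0ℚ → ∀ l → A k l ≡ true → x l ≡ x k
harmonic-at-max {n} {A} simple x k x≤xk Lx≡0 l kl = sym (ℚGroup.x∙y⁻¹≈ε⇒x≈y (x k) (x l) (begin
  x k - x l                  ≡⟨ ℚP.*-identityˡ (x k - x l) ⟨
  1ℚ * (x k - x l)           ≡⟨ cong (λ b → ℕ→ℚ (b2n b) * (x k - x l)) kl ⟨
  adjℚ A k l * (x k - x l)   ≡⟨ Σℚ-nonneg-≡0 _ term-nonneg (trans (sym (laplacian-·ᵥ simple x k)) Lx≡0) l ⟩
  0ℚ                         ∎))
  where
  term-nonneg : ∀ j → 0ℚ ≤ℚ adjℚ A k j * (x k - x j)
  term-nonneg j with A k j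
  ... | true  = ℚP.≤-trans (p≤q⇒0≤q-p (x≤xk j)) (ℚP.≤-reflexive (sym (ℚP.*-identityˡ (x k - x j))))
  ... | false = ℚP.≤-reflexive (sym (ℚP.*-zeroˡ (x k - x j)))

harmonic-constant : ∀ {n} {A : Adj n} → IsSimple A → Connected A → ∀ (x : Fin n → ℚ) →
  (∀ k → (laplacian A ·ᵥ x) k ≡ 0ℚ) → ∀ i j → x i ≡ x j
harmonic-constant {suc n} {A} simple connected x Lx≡0 i j =
  trans (spread (connected top i) refl) (sym (spread (connected top j) refl))
  where
  top = proj₁ (max-attained x)
  spread : ∀ {p q} → Reach A p q → x p ≡ x top → x q ≡ x top
  spread here                   xp≡max = xp≡max
  spread (step {p} {r} pr walk) xp≡max = spread walk (trans
    (harmonic-at-max simple x p (λ j → subst (x j ≤ℚ_) (sym xp≡max) (proj₂ (max-attained x) j)) (Lx≡0 p) r pr)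
    xp≡max)

-- Effective resistances from potentials

·-assoc : ∀ {n} (M N R : Matrix n) i j → ((M · N) · R) i j ≡ (M · (N · R)) i j
·-assoc {n} M N R i j = begin
  Σℚ n (λ l → Σℚ n (λ k → M i k * N k l) * R l j)
    ≡⟨ Σℚ-cong (λ l → trans (ℚP.*-comm _ (R l j)) (sym (Σℚ-*ˡ (R l j) (λ k → M i k * N k l)))) ⟩
  Σℚ n (λ l → Σℚ n (λ k → R l j * (M i k * N k l)))
    ≡⟨ Σℚ-comm {n} {n} _ ⟩
  Σℚ n (λ k → Σℚ n (λ l → R l j * (M i k * N k l)))
    ≡⟨ Σℚ-cong (λ k → trans (Σℚ-cong (λ l → reassoc (R l j) (M i k) (N k l))) (Σℚ-*ˡ {n} (M i k) _)) ⟩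
  Σℚ n (λ k → M i k * Σℚ n (λ l → N k l * R l j)) ∎
  where
  reassoc : ∀ r m p → r * (m * p) ≡ m * (p * r)
  reassoc = solve-∀ ℚ-ring

resistance-sym : ∀ {n} (M : Matrix n) i j → resistance M i j ≡ resistance M j i
resistance-sym M i j = swap (M i i) (M j j) (M i j) (M j i)
  where
  swap : ∀ a b c d → ((a + b) - c) - d ≡ ((b + a) - d) - c
  swap = solve-∀ ℚ-ring

resistance-self : ∀ {n} (M : Matrix n) i → resistance M i i ≡ 0ℚ
resistance-self M i = cancel (M i i)
  where
  cancel : ∀ a → ((a + a) - a) - a ≡ 0ℚ
  cancel = solve-∀ ℚ-ring

potential : ∀ {n} → Matrix n → Fin n → Fin n → Fin n → ℚ
potential X i j l = X l i - X l j

resistance≡potential : ∀ {n} (X : Matrix n) i j → resistance X i j ≡ potential X i j i - potential X i j j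
resistance≡potential X i j = regroup (X i i) (X j j) (X i j) (X j i)
  where
  regroup : ∀ a b c d → ((a + b) - c) - d ≡ (a - c) - (d - b)
  regroup = solve-∀ ℚ-ring

module MoorePenrose {n} {A : Adj n} (simple : IsSimple A) (connected : Connected A)
                    {X : Matrix n} (X-mp : IsMPInverse (laplacian A) X) where

  private
    L = laplacian A
    P = L · X

    LXL≡L : ∀ i j → (L · (X · L)) i j ≡ L i j
    LXL≡L = proj₁ X-mp

    LX-sym : ∀ i j → P i j ≡ P j i
    LX-sym = proj₁ (proj₂ (proj₂ X-mp))

    P·L≡L : ∀ i j → (P · L) i j ≡ L i j
    P·L≡L i j = trans (·-assoc L X L i j) (LXL≡L i j)

    L·P≡L : ∀ i j → (L · P) i j ≡ L i j
    L·P≡L i j = begin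
      Σℚ n (λ k → L i k * P k j)
        ≡⟨ Σℚ-cong (λ k → trans (cong₂ _*_ (laplacian-sym simple i k) (LX-sym k j)) (ℚP.*-comm (L k i) (P j k))) ⟩
      (P · L) j i ≡⟨ P·L≡L j i ⟩
      L j i       ≡⟨ laplacian-sym simple j i ⟩
      L i j       ∎

    -- P projects onto the range of L, the vectors orthogonal to the constants, so P - I is constant.
    P-I : Matrix n
    P-I k j = P k j - δ j k

    P-I-columns-harmonic : ∀ j k → (L ·ᵥ (λ l → P-I l j)) k ≡ 0ℚ
    P-I-columns-harmonic j k = begin
      (L ·ᵥ (λ l → P-I l j)) k                    ≡⟨ ·ᵥ-distrib-- L (λ l → P l j) (λ l → δ j l) k ⟩
      (L · P) k j - (L ·ᵥ δ j) k                  ≡⟨ cong₂ _-_ (L·P≡L k j) (Σℚ-*δ (L k) j) ⟩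
      L k j - L k j                               ≡⟨ ℚP.+-inverseʳ (L k j) ⟩
      0ℚ                                          ∎

    P-I-rows-constant : ∀ k i j → P-I k i ≡ P-I k j
    P-I-rows-constant k i j = begin
      P-I k i ≡⟨ column i k i ⟩
      P-I i i ≡⟨ column i i j ⟩
      P-I j i ≡⟨ cong₂ _-_ (LX-sym j i) (δ-sym i j) ⟩
      P-I i j ≡⟨ column j i k ⟩
      P-I k j ∎
      where
      column : ∀ j k l → P-I k j ≡ P-I l j
      column j = harmonic-constant simple connected (λ l → P-I l j) (P-I-columns-harmonic j)

  laplacian-potential : ∀ i j k → (L ·ᵥ potential X i j) k ≡ δ i k - δ j k
  laplacian-potential i j k = begin
    (L ·ᵥ potential X i j) k                        ≡⟨ ·ᵥ-distrib-- L (λ l → X l i) (λ l → X l j) k ⟩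
    P k i - P k j                                 ≡⟨ split (P k i) (P k j) (δ i k) (δ j k) ⟩
    (P-I k i - P-I k j) + (δ i k - δ j k)         ≡⟨ cong (λ c → (c - P-I k j) + (δ i k - δ j k)) (P-I-rows-constant k i j) ⟩
    (P-I k j - P-I k j) + (δ i k - δ j k)         ≡⟨ cancel (P-I k j) (δ i k - δ j k) ⟩
    δ i k - δ j k                                 ∎
    where
    split : ∀ a b p q → a - b ≡ ((a - p) - (b - q)) + (p - q)
    split = solve-∀ ℚ-ring
    cancel : ∀ a b → (a - a) + b ≡ b
    cancel = solve-∀ ℚ-ring

  resistance≡potential-difference : ∀ i j (u : Fin n → ℚ) →
    (∀ k → (L ·ᵥ u) k ≡ δ i k - δ j k) → resistance X i j ≡ u i - u j
  resistance≡potential-difference i j u Lu≡δi-δj = begin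
    resistance X i j                                   ≡⟨ resistance≡potential X i j ⟩
    potential X i j i - potential X i j j              ≡⟨ shift (u i) (u j) (potential X i j i) (potential X i j j) ⟩
    (u i - u j) - (w i - w j)
      ≡⟨ cong (λ c → (u i - u j) - (c - w j)) (harmonic-constant simple connected w Lw≡0 i j) ⟩
    (u i - u j) - (w j - w j)                          ≡⟨ cancel (u i - u j) (w j) ⟩
    u i - u j                                          ∎
    where
    w : Fin n → ℚ
    w l = u l - potential X i j l
    Lw≡0 : ∀ k → (L ·ᵥ w) k ≡ 0ℚ
    Lw≡0 k = begin
      (L ·ᵥ w) k                                       ≡⟨ ·ᵥ-distrib-- L u (potential X i j) k ⟩
      (L ·ᵥ u) k - (L ·ᵥ potential X i j) k            ≡⟨ cong₂ _-_ (Lu≡δi-δj k) (laplacian-potential i j k) ⟩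
      (δ i k - δ j k) - (δ i k - δ j k)                ≡⟨ ℚP.+-inverseʳ (δ i k - δ j k) ⟩
      0ℚ                                               ∎
    shift : ∀ a b p q → p - q ≡ (a - b) - ((a - p) - (b - q))
    shift = solve-∀ ℚ-ring
    cancel : ∀ a b → a - (b - b) ≡ a
    cancel = solve-∀ ℚ-ring

-- The weighted resistance sum after attaching K4

pairSum : ∀ {n} → (Fin n → ℚ) → Matrix n → ℚ
pairSum {n} w R = Σℚ n (λ i → Σℚ n (λ j → (w i * w j) * R i j))

pairSum≡Σ-rows : ∀ {n} (w : Fin n → ℚ) (R : Matrix n) →
  pairSum w R ≡ Σℚ n (λ i → w i * Σℚ n (λ j → w j * R i j))
pairSum≡Σ-rows {n} w R = Σℚ-cong (λ i → trans (Σℚ-cong (λ j → ℚP.*-assoc (w i) (w j) (R i j))) (Σℚ-*ˡ {n} (w i) _))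

pairSum-cong : ∀ {n} {w w′ : Fin n → ℚ} {R R′ : Matrix n} →
  (∀ i → w i ≡ w′ i) → (∀ i j → R i j ≡ R′ i j) → pairSum w R ≡ pairSum w′ R′
pairSum-cong w≗w′ R≗R′ = Σℚ-cong (λ i → Σℚ-cong (λ j → cong₂ _*_ (cong₂ _*_ (w≗w′ i) (w≗w′ j)) (R≗R′ i j)))

pattern new₀  = zero
pattern new₁  = suc zero
pattern new₂  = suc (suc zero)
pattern old k = suc (suc (suc k))

¼ : ℚ
¼ = ½ * ½

K4-degrees : ∀ {n} → Fin n → (Fin n → ℚ) → Fin (suc (suc (suc n))) → ℚ
K4-degrees v d (old k) = d k + ℕ→ℚ 3 * δ v k
K4-degrees v d _       = ℕ→ℚ 3

K4-resistances : ∀ {n} → Fin n → Matrix n → Matrix (suc (suc (suc n)))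
K4-resistances v R (old i) (old j) = R i j
K4-resistances v R (old i) _       = R i v + ½
K4-resistances v R _       (old j) = R j v + ½
K4-resistances v R s       t       = ½ * (1ℚ - δ s t)

module _ {n} (v : Fin n) (d : Fin n → ℚ) (R : Matrix n)
         (R-sym : ∀ k → R v k ≡ R k v) (Rvv≡0 : R v v ≡ 0ℚ) where

  private
    d⁺  = K4-degrees v d
    R⁺  = K4-resistances v R
    μ   = Σℚ n (λ k → d k * R k v)
    row : Matrix n → Fin n → ℚ
    row M k = Σℚ n (λ l → d l * M k l)

    Σ-old : ∀ g → Σℚ n (λ k → d⁺ (old k) * g k) ≡ Σℚ n (λ k → d k * g k) + ℕ→ℚ 3 * g v
    Σ-old g = begin
      Σℚ n (λ k → d⁺ (old k) * g k)
        ≡⟨ Σℚ-cong (λ k → expand (d k) (δ v k) (g k)) ⟩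
      Σℚ n (λ k → d k * g k + ℕ→ℚ 3 * (δ v k * g k))
        ≡⟨ Σℚ-distrib-+ (λ k → d k * g k) (λ k → ℕ→ℚ 3 * (δ v k * g k)) ⟩
      Σℚ n (λ k → d k * g k) + Σℚ n (λ k → ℕ→ℚ 3 * (δ v k * g k))
        ≡⟨ cong (_+_ (Σℚ n (λ k → d k * g k))) (Σℚ-*ˡ (ℕ→ℚ 3) (λ k → δ v k * g k)) ⟩
      Σℚ n (λ k → d k * g k) + ℕ→ℚ 3 * Σℚ n (λ k → δ v k * g k)
        ≡⟨ cong (λ x → Σℚ n (λ k → d k * g k) + ℕ→ℚ 3 * x) (Σℚ-δ g v) ⟩
      Σℚ n (λ k → d k * g k) + ℕ→ℚ 3 * g v ∎
      where
      expand : ∀ a e x → (a + ℕ→ℚ 3 * e) * x ≡ a * x + ℕ→ℚ 3 * (e * x)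
      expand = solve-∀ ℚ-ring

    h : Fin n → ℚ
    h k = R k v + ½

    Σ-linear : ∀ a b (f g e : Fin n → ℚ) →
      Σℚ n (λ k → d k * (a * f k + (g k + b * e k)))
        ≡ a * Σℚ n (λ k → d k * f k) + (Σℚ n (λ k → d k * g k) + b * Σℚ n (λ k → d k * e k))
    Σ-linear a b f g e = begin
      Σℚ n (λ k → d k * (a * f k + (g k + b * e k)))
        ≡⟨ Σℚ-cong (λ k → expand (d k) a b (f k) (g k) (e k)) ⟩
      Σℚ n (λ k → a * (d k * f k) + (d k * g k + b * (d k * e k)))
        ≡⟨ Σℚ-distrib-+ (λ k → a * (d k * f k)) (λ k → d k * g k + b * (d k * e k)) ⟩
      Σℚ n (λ k → a * (d k * f k)) + Σℚ n (λ k → d k * g k + b * (d k * e k))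
        ≡⟨ cong₂ _+_ (Σℚ-*ˡ a (λ k → d k * f k))
             (trans (Σℚ-distrib-+ (λ k → d k * g k) (λ k → b * (d k * e k)))
                    (cong (_+_ (Σℚ n (λ k → d k * g k))) (Σℚ-*ˡ b (λ k → d k * e k)))) ⟩
      a * Σℚ n (λ k → d k * f k) + (Σℚ n (λ k → d k * g k) + b * Σℚ n (λ k → d k * e k)) ∎
      where
      expand : ∀ d a b f g e → d * (a * f + (g + b * e)) ≡ a * (d * f) + (d * g + b * (d * e))
      expand = solve-∀ ℚ-ring

    Σ-d-h : Σℚ n (λ k → d k * h k) ≡ μ + ½ * Σℚ n d
    Σ-d-h = begin
      Σℚ n (λ k → d k * h k)                                ≡⟨ Σℚ-cong (λ k → expand (d k) (R k v)) ⟩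
      Σℚ n (λ k → d k * R k v + ½ * d k)                    ≡⟨ Σℚ-distrib-+ (λ k → d k * R k v) (λ k → ½ * d k) ⟩
      μ + Σℚ n (λ k → ½ * d k)                              ≡⟨ cong (_+_ μ) (Σℚ-*ˡ ½ d) ⟩
      μ + ½ * Σℚ n d                                        ∎
      where
      expand : ∀ d r → d * (r + ½) ≡ d * r + ½ * d
      expand = solve-∀ ℚ-ring

    row⁺ : Fin (suc (suc (suc n))) → ℚ
    row⁺ s = Σℚ (suc (suc (suc n))) (λ t → d⁺ t * R⁺ s t)

    new-row : ∀ x y z → x + y + z ≡ 1ℚ →
      ℕ→ℚ 3 * x + (ℕ→ℚ 3 * y + (ℕ→ℚ 3 * z + Σℚ n (λ k → d⁺ (old k) * h k)))
        ≡ ℕ→ℚ 3 + ((μ + ½ * Σℚ n d) + ℕ→ℚ 3 * ½)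
    new-row x y z x+y+z≡1 = begin
      ℕ→ℚ 3 * x + (ℕ→ℚ 3 * y + (ℕ→ℚ 3 * z + H))   ≡⟨ collect x y z H ⟩
      ℕ→ℚ 3 * (x + y + z) + H                     ≡⟨ cong (λ c → ℕ→ℚ 3 * c + H) x+y+z≡1 ⟩
      ℕ→ℚ 3 * 1ℚ + H                              ≡⟨ cong₂ _+_ (ℚP.*-identityʳ (ℕ→ℚ 3)) H-value ⟩
      ℕ→ℚ 3 + ((μ + ½ * Σℚ n d) + ℕ→ℚ 3 * ½)      ∎
      where
      H = Σℚ n (λ k → d⁺ (old k) * h k)
      collect : ∀ x y z H → ℕ→ℚ 3 * x + (ℕ→ℚ 3 * y + (ℕ→ℚ 3 * z + H)) ≡ ℕ→ℚ 3 * (x + y + z) + H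
      collect = solve-∀ ℚ-ring
      H-value : H ≡ (μ + ½ * Σℚ n d) + ℕ→ℚ 3 * ½
      H-value = trans (Σ-old h) (cong₂ _+_ Σ-d-h (cong (λ r → ℕ→ℚ 3 * (r + ½)) Rvv≡0))

    old-row : ∀ k → row⁺ (old k) ≡ ℕ→ℚ 9 * h k + (row R k + ℕ→ℚ 3 * R k v)
    old-row k = begin
      ℕ→ℚ 3 * h k + (ℕ→ℚ 3 * h k + (ℕ→ℚ 3 * h k + Σℚ n (λ l → d⁺ (old l) * R k l)))
        ≡⟨ cong (λ T → ℕ→ℚ 3 * h k + (ℕ→ℚ 3 * h k + (ℕ→ℚ 3 * h k + T))) (Σ-old (R k)) ⟩
      ℕ→ℚ 3 * h k + (ℕ→ℚ 3 * h k + (ℕ→ℚ 3 * h k + (row R k + ℕ→ℚ 3 * R k v)))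
        ≡⟨ collect (h k) (row R k + ℕ→ℚ 3 * R k v) ⟩
      ℕ→ℚ 9 * h k + (row R k + ℕ→ℚ 3 * R k v) ∎
      where
      collect : ∀ x T → ℕ→ℚ 3 * x + (ℕ→ℚ 3 * x + (ℕ→ℚ 3 * x + T)) ≡ ℕ→ℚ 9 * x + T
      collect = solve-∀ ℚ-ring

    old-rows : Σℚ n (λ k → d⁺ (old k) * row⁺ (old k))
      ≡ (ℕ→ℚ 9 * (μ + ½ * Σℚ n d) + (pairSum d R + ℕ→ℚ 3 * μ)) + ℕ→ℚ 3 * (ℕ→ℚ 9 * ½ + μ)
    old-rows = begin
      Σℚ n (λ k → d⁺ (old k) * row⁺ (old k))         ≡⟨ Σℚ-cong (λ k → cong (d⁺ (old k) *_) (old-row k)) ⟩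
      Σℚ n (λ k → d⁺ (old k) * f k)                  ≡⟨ Σ-old f ⟩
      Σℚ n (λ k → d k * f k) + ℕ→ℚ 3 * f v           ≡⟨ cong₂ _+_ Σ-d-f (cong (ℕ→ℚ 3 *_) f-v) ⟩
      (ℕ→ℚ 9 * (μ + ½ * Σℚ n d) + (pairSum d R + ℕ→ℚ 3 * μ)) + ℕ→ℚ 3 * (ℕ→ℚ 9 * ½ + μ) ∎
      where
      f : Fin n → ℚ
      f k = ℕ→ℚ 9 * h k + (row R k + ℕ→ℚ 3 * R k v)
      Σ-d-f : Σℚ n (λ k → d k * f k) ≡ ℕ→ℚ 9 * (μ + ½ * Σℚ n d) + (pairSum d R + ℕ→ℚ 3 * μ)
      Σ-d-f = trans (Σ-linear (ℕ→ℚ 9) (ℕ→ℚ 3) h (row R) (λ k → R k v))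
                (cong₂ (λ a b → ℕ→ℚ 9 * a + (b + ℕ→ℚ 3 * μ)) Σ-d-h (sym (pairSum≡Σ-rows d R)))
      f-v : f v ≡ ℕ→ℚ 9 * ½ + μ
      f-v = begin
        ℕ→ℚ 9 * (R v v + ½) + (row R v + ℕ→ℚ 3 * R v v)
          ≡⟨ cong₂ (λ r ρ → ℕ→ℚ 9 * (r + ½) + (ρ + ℕ→ℚ 3 * r)) Rvv≡0 (Σℚ-cong (λ l → cong (d l *_) (R-sym l))) ⟩
        ℕ→ℚ 9 * (0ℚ + ½) + (μ + ℕ→ℚ 3 * 0ℚ)
          ≡⟨ simplify μ ⟩
        ℕ→ℚ 9 * ½ + μ ∎
        where
        simplify : ∀ μ → ℕ→ℚ 9 * (0ℚ + ½) + (μ + ℕ→ℚ 3 * 0ℚ) ≡ ℕ→ℚ 9 * ½ + μ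
        simplify = solve-∀ ℚ-ring

  pairSum-K4 : pairSum (K4-degrees v d) (K4-resistances v R)
    ≡ ((pairSum d R + ℕ→ℚ 24 * Σℚ n (λ k → d k * R k v)) + ℕ→ℚ 9 * Σℚ n d) + ℕ→ℚ 54
  pairSum-K4 = begin
    pairSum d⁺ R⁺
      ≡⟨ pairSum≡Σ-rows d⁺ R⁺ ⟩
    ℕ→ℚ 3 * row⁺ new₀ + (ℕ→ℚ 3 * row⁺ new₁ + (ℕ→ℚ 3 * row⁺ new₂ + Σℚ n (λ k → d⁺ (old k) * row⁺ (old k))))
      ≡⟨ cong₂ _+_ (cong (ℕ→ℚ 3 *_) (new-row (R⁺ new₀ new₀) (R⁺ new₀ new₁) (R⁺ new₀ new₂) refl))
           (cong₂ _+_ (cong (ℕ→ℚ 3 *_) (new-row (R⁺ new₁ new₀) (R⁺ new₁ new₁) (R⁺ new₁ new₂) refl))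
             (cong₂ _+_ (cong (ℕ→ℚ 3 *_) (new-row (R⁺ new₂ new₀) (R⁺ new₂ new₁) (R⁺ new₂ new₂) refl))
               old-rows)) ⟩
    ℕ→ℚ 3 * N + (ℕ→ℚ 3 * N + (ℕ→ℚ 3 * N +
      ((ℕ→ℚ 9 * (μ + ½ * Σℚ n d) + (pairSum d R + ℕ→ℚ 3 * μ)) + ℕ→ℚ 3 * (ℕ→ℚ 9 * ½ + μ))))
      ≡⟨ total μ (Σℚ n d) (pairSum d R) ⟩
    ((pairSum d R + ℕ→ℚ 24 * μ) + ℕ→ℚ 9 * Σℚ n d) + ℕ→ℚ 54 ∎
    where
    N = ℕ→ℚ 3 + ((μ + ½ * Σℚ n d) + ℕ→ℚ 3 * ½)
    total : ∀ μ D S →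
      ℕ→ℚ 3 * (ℕ→ℚ 3 + ((μ + ½ * D) + ℕ→ℚ 3 * ½)) + (ℕ→ℚ 3 * (ℕ→ℚ 3 + ((μ + ½ * D) + ℕ→ℚ 3 * ½)) +
        (ℕ→ℚ 3 * (ℕ→ℚ 3 + ((μ + ½ * D) + ℕ→ℚ 3 * ½)) +
          ((ℕ→ℚ 9 * (μ + ½ * D) + (S + ℕ→ℚ 3 * μ)) + ℕ→ℚ 3 * (ℕ→ℚ 9 * ½ + μ))))
        ≡ ((S + ℕ→ℚ 24 * μ) + ℕ→ℚ 9 * D) + ℕ→ℚ 54
    total = solve-∀ ℚ-ring

-- Attaching K4 to a graph

degℚ : ∀ {n} → Adj n → Fin n → ℚ
degℚ A k = ℕ→ℚ (deg A k)

Σℕ-isV : ∀ {n} (v : Fin n) → Σℕ n (λ k → b2n (isV v k)) ≡ 1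
Σℕ-isV {suc n} zero    = cong suc (Σℕ-zero n)
  where
  Σℕ-zero : ∀ n → Σℕ n (λ k → b2n (isV {suc n} zero (suc k))) ≡ 0
  Σℕ-zero zero    = refl
  Σℕ-zero (suc n) = Σℕ-zero n
Σℕ-isV {suc n} (suc v) = Σℕ-isV v

Reach-++ : ∀ {n} {A : Adj n} {i j k} → Reach A i j → Reach A j k → Reach A i k
Reach-++ here           walk′ = walk′
Reach-++ (step ij walk) walk′ = step ij (Reach-++ walk walk′)

module AttachK4 {n} {G : Adj n} (simple : IsSimple G) (v : Fin n) where

  G⁺ : Adj (suc (suc (suc n)))
  G⁺ = attachK4 G v

  attachK4-sym : ∀ s t → G⁺ s t ≡ G⁺ t s
  attachK4-sym (old i) (old j) = proj₁ simple i j
  attachK4-sym (old i) new₀    = refl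
  attachK4-sym (old i) new₁    = refl
  attachK4-sym (old i) new₂    = refl
  attachK4-sym new₀    (old j) = refl
  attachK4-sym new₁    (old j) = refl
  attachK4-sym new₂    (old j) = refl
  attachK4-sym new₀    new₀    = refl
  attachK4-sym new₀    new₁    = refl
  attachK4-sym new₀    new₂    = refl
  attachK4-sym new₁    new₀    = refl
  attachK4-sym new₁    new₁    = refl
  attachK4-sym new₁    new₂    = refl
  attachK4-sym new₂    new₀    = refl
  attachK4-sym new₂    new₁    = refl
  attachK4-sym new₂    new₂    = refl

  attachK4-irrefl : ∀ s → G⁺ s s ≡ false
  attachK4-irrefl (old k) = proj₂ simple k
  attachK4-irrefl new₀    = refl
  attachK4-irrefl new₁    = refl
  attachK4-irrefl new₂    = refl

  simple⁺ : IsSimple G⁺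
  simple⁺ = attachK4-sym , attachK4-irrefl

  v~v : isV v v ≡ true
  v~v = dec-true (v Fin.≟ v) refl

  connected⁺ : Connected G → Connected G⁺
  connected⁺ connected s t = Reach-++ (to-v s) (from-v t)
    where
    lift : ∀ {i j} → Reach G i j → Reach G⁺ (old i) (old j)
    lift here           = here
    lift (step ij walk) = step ij (lift walk)
    to-v : ∀ s → Reach G⁺ s (old v)
    to-v new₀    = step v~v here
    to-v new₁    = step v~v here
    to-v new₂    = step v~v here
    to-v (old k) = lift (connected k v)
    from-v : ∀ t → Reach G⁺ (old v) t
    from-v new₀    = step v~v here
    from-v new₁    = step v~v here
    from-v new₂    = step v~v here
    from-v (old k) = lift (connected v k)

  edges-attachK4 : edges G⁺ ≡ 6 ℕ.+ edges G
  edges-attachK4 = cong (λ s → (2 ℕ.+ s) ℕ.+ ((1 ℕ.+ s) ℕ.+ (s ℕ.+ edges G))) (Σℕ-isV v)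

  deg-attachK4 : ∀ s → degℚ G⁺ s ≡ K4-degrees v (degℚ G) s
  deg-attachK4 new₀    = cong (λ s → ℕ→ℚ (2 ℕ.+ s)) (Σℕ-isV v)
  deg-attachK4 new₁    = cong (λ s → ℕ→ℚ (2 ℕ.+ s)) (Σℕ-isV v)
  deg-attachK4 new₂    = cong (λ s → ℕ→ℚ (2 ℕ.+ s)) (Σℕ-isV v)
  deg-attachK4 (old k) = begin
    ℕ→ℚ (b ℕ.+ (b ℕ.+ (b ℕ.+ deg G k)))
      ≡⟨ trans (ℕ→ℚ-+ b _) (cong (_+_ (δ v k)) (trans (ℕ→ℚ-+ b _) (cong (_+_ (δ v k)) (ℕ→ℚ-+ b (deg G k))))) ⟩
    δ v k + (δ v k + (δ v k + degℚ G k)) ≡⟨ collect (δ v k) (degℚ G k) ⟩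
    degℚ G k + ℕ→ℚ 3 * δ v k             ∎
    where
    b = b2n (isV v k)
    collect : ∀ e d → e + (e + (e + d)) ≡ d + ℕ→ℚ 3 * e
    collect = solve-∀ ℚ-ring

  extend : (Fin n → ℚ) → ℚ → ℚ → ℚ → Fin (suc (suc (suc n))) → ℚ
  extend u c₀ c₁ c₂ new₀    = u v + c₀
  extend u c₀ c₁ c₂ new₁    = u v + c₁
  extend u c₀ c₁ c₂ new₂    = u v + c₂
  extend u c₀ c₁ c₂ (old k) = u k

  laplacian-extend-old : ∀ u c₀ c₁ c₂ k →
    (laplacian G⁺ ·ᵥ extend u c₀ c₁ c₂) (old k) ≡ (laplacian G ·ᵥ u) k - δ v k * (c₀ + c₁ + c₂)
  laplacian-extend-old u c₀ c₁ c₂ k = begin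
    (laplacian G⁺ ·ᵥ extend u c₀ c₁ c₂) (old k)
      ≡⟨ laplacian-·ᵥ simple⁺ (extend u c₀ c₁ c₂) (old k) ⟩
    e * (u k - (u v + c₀)) + (e * (u k - (u v + c₁)) + (e * (u k - (u v + c₂)) +
      Σℚ n (λ l → adjℚ G k l * (u k - u l))))
      ≡⟨ cong (λ T → e * (u k - (u v + c₀)) + (e * (u k - (u v + c₁)) + (e * (u k - (u v + c₂)) + T)))
              (sym (laplacian-·ᵥ simple u k)) ⟩
    e * (u k - (u v + c₀)) + (e * (u k - (u v + c₁)) + (e * (u k - (u v + c₂)) + Lu))
      ≡⟨ regroup e (u k) (u v) c₀ c₁ c₂ Lu ⟩
    ℕ→ℚ 3 * (e * (u k - u v)) + (Lu - e * (c₀ + c₁ + c₂))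
      ≡⟨ cong (λ z → ℕ→ℚ 3 * z + (Lu - e * (c₀ + c₁ + c₂))) (δ-*-difference u v k) ⟩
    ℕ→ℚ 3 * 0ℚ + (Lu - e * (c₀ + c₁ + c₂))
      ≡⟨ drop (Lu - e * (c₀ + c₁ + c₂)) ⟩
    Lu - e * (c₀ + c₁ + c₂) ∎
    where
    e  = δ v k
    Lu = (laplacian G ·ᵥ u) k
    regroup : ∀ e p q c₀ c₁ c₂ T →
      e * (p - (q + c₀)) + (e * (p - (q + c₁)) + (e * (p - (q + c₂)) + T))
        ≡ ℕ→ℚ 3 * (e * (p - q)) + (T - e * (c₀ + c₁ + c₂))
    regroup = solve-∀ ℚ-ring
    drop : ∀ T → ℕ→ℚ 3 * 0ℚ + T ≡ T
    drop = solve-∀ ℚ-ring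

  laplacian-·ᵥ-new : ∀ (x : Fin (suc (suc (suc n))) → ℚ) s → (∀ l → G⁺ s (old l) ≡ isV v l) →
    (laplacian G⁺ ·ᵥ x) s
      ≡ adjℚ G⁺ s new₀ * (x s - x new₀) + (adjℚ G⁺ s new₁ * (x s - x new₁) +
          (adjℚ G⁺ s new₂ * (x s - x new₂) + (x s - x (old v))))
  laplacian-·ᵥ-new x s s~l≡l~v = trans (laplacian-·ᵥ simple⁺ x s)
    (cong (λ T → adjℚ G⁺ s new₀ * (x s - x new₀) + (adjℚ G⁺ s new₁ * (x s - x new₁) +
                   (adjℚ G⁺ s new₂ * (x s - x new₂) + T)))
      (trans (Σℚ-cong (λ l → cong (λ b → ℕ→ℚ (b2n b) * (x s - x (old l))) (s~l≡l~v l)))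
             (Σℚ-δ (λ l → x s - x (old l)) v)))

  laplacian-extend-new₀ : ∀ u c₀ c₁ c₂ → (laplacian G⁺ ·ᵥ extend u c₀ c₁ c₂) new₀ ≡ ℕ→ℚ 4 * c₀ - (c₀ + c₁ + c₂)
  laplacian-extend-new₀ u c₀ c₁ c₂ = trans (laplacian-·ᵥ-new (extend u c₀ c₁ c₂) new₀ (λ _ → refl)) (row (u v) c₀ c₁ c₂)
    where
    row : ∀ p c₀ c₁ c₂ →
      0ℚ * ((p + c₀) - (p + c₀)) + (1ℚ * ((p + c₀) - (p + c₁)) + (1ℚ * ((p + c₀) - (p + c₂)) + ((p + c₀) - p)))
        ≡ ℕ→ℚ 4 * c₀ - (c₀ + c₁ + c₂)
    row = solve-∀ ℚ-ring

  laplacian-extend-new₁ : ∀ u c₀ c₁ c₂ → (laplacian G⁺ ·ᵥ extend u c₀ c₁ c₂) new₁ ≡ ℕ→ℚ 4 * c₁ - (c₀ + c₁ + c₂)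
  laplacian-extend-new₁ u c₀ c₁ c₂ = trans (laplacian-·ᵥ-new (extend u c₀ c₁ c₂) new₁ (λ _ → refl)) (row (u v) c₀ c₁ c₂)
    where
    row : ∀ p c₀ c₁ c₂ →
      1ℚ * ((p + c₁) - (p + c₀)) + (0ℚ * ((p + c₁) - (p + c₁)) + (1ℚ * ((p + c₁) - (p + c₂)) + ((p + c₁) - p)))
        ≡ ℕ→ℚ 4 * c₁ - (c₀ + c₁ + c₂)
    row = solve-∀ ℚ-ring

  laplacian-extend-new₂ : ∀ u c₀ c₁ c₂ → (laplacian G⁺ ·ᵥ extend u c₀ c₁ c₂) new₂ ≡ ℕ→ℚ 4 * c₂ - (c₀ + c₁ + c₂)
  laplacian-extend-new₂ u c₀ c₁ c₂ = trans (laplacian-·ᵥ-new (extend u c₀ c₁ c₂) new₂ (λ _ → refl)) (row (u v) c₀ c₁ c₂)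
    where
    row : ∀ p c₀ c₁ c₂ →
      1ℚ * ((p + c₂) - (p + c₀)) + (1ℚ * ((p + c₂) - (p + c₁)) + (0ℚ * ((p + c₂) - (p + c₂)) + ((p + c₂) - p)))
        ≡ ℕ→ℚ 4 * c₂ - (c₀ + c₁ + c₂)
    row = solve-∀ ℚ-ring

  module Resistances (connected : Connected G)
                     {X : Matrix n} (X-mp : IsMPInverse (laplacian G) X)
                     {Y : Matrix (suc (suc (suc n)))} (Y-mp : IsMPInverse (laplacian G⁺) Y) where

    open MoorePenrose simple connected X-mp
    module MP⁺ = MoorePenrose simple⁺ (connected⁺ connected) Y-mp

    resistance-extend : ∀ u c₀ c₁ c₂ s t →
      (∀ k → (laplacian G ·ᵥ u) k - δ v k * (c₀ + c₁ + c₂) ≡ δ s (old k) - δ t (old k)) →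
      ℕ→ℚ 4 * c₀ - (c₀ + c₁ + c₂) ≡ δ s new₀ - δ t new₀ →
      ℕ→ℚ 4 * c₁ - (c₀ + c₁ + c₂) ≡ δ s new₁ - δ t new₁ →
      ℕ→ℚ 4 * c₂ - (c₀ + c₁ + c₂) ≡ δ s new₂ - δ t new₂ →
      resistance Y s t ≡ extend u c₀ c₁ c₂ s - extend u c₀ c₁ c₂ t
    resistance-extend u c₀ c₁ c₂ s t old-ok new₀-ok new₁-ok new₂-ok =
      MP⁺.resistance≡potential-difference s t (extend u c₀ c₁ c₂) L⁺x≡δs-δt
      where
      L⁺x≡δs-δt : ∀ r → (laplacian G⁺ ·ᵥ extend u c₀ c₁ c₂) r ≡ δ s r - δ t r
      L⁺x≡δs-δt new₀    = trans (laplacian-extend-new₀ u c₀ c₁ c₂) new₀-ok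
      L⁺x≡δs-δt new₁    = trans (laplacian-extend-new₁ u c₀ c₁ c₂) new₁-ok
      L⁺x≡δs-δt new₂    = trans (laplacian-extend-new₂ u c₀ c₁ c₂) new₂-ok
      L⁺x≡δs-δt (old k) = trans (laplacian-extend-old u c₀ c₁ c₂ k) (old-ok k)

    private
      r = resistance X

      old-old : ∀ i j → resistance Y (old i) (old j) ≡ r i j
      old-old i j = trans
        (resistance-extend (potential X i j) 0ℚ 0ℚ 0ℚ (old i) (old j) condition refl refl refl)
        (sym (resistance≡potential X i j))
        where
        no-shift : ∀ a e → a - e * (0ℚ + 0ℚ + 0ℚ) ≡ a
        no-shift = solve-∀ ℚ-ring
        condition : ∀ k → (laplacian G ·ᵥ potential X i j) k - δ v k * (0ℚ + 0ℚ + 0ℚ) ≡ δ i k - δ j k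
        condition k = trans (no-shift _ (δ v k)) (laplacian-potential i j k)

      new-old : ∀ j k → (laplacian G ·ᵥ potential X v j) k - δ v k * 1ℚ ≡ 0ℚ - δ j k
      new-old j k = trans (cong (λ a → a - δ v k * 1ℚ) (laplacian-potential v j k)) (cancel (δ v k) (δ j k))
        where
        cancel : ∀ e f → (e - f) - e * 1ℚ ≡ 0ℚ - f
        cancel = solve-∀ ℚ-ring

      new-old-value : ∀ j → (potential X v j v + ½) - potential X v j j ≡ r j v + ½
      new-old-value j = trans (shift (potential X v j v) (potential X v j j) ½)
        (cong (_+ ½) (trans (sym (resistance≡potential X v j)) (resistance-sym X v j)))
        where
        shift : ∀ a b c → (a + c) - b ≡ (a - b) + c
        shift = solve-∀ ℚ-ring

      new-new : ∀ k → (laplacian G ·ᵥ potential X v v) k - δ v k * 0ℚ ≡ 0ℚ - 0ℚ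
      new-new k = trans (cong (λ a → a - δ v k * 0ℚ) (laplacian-potential v v k)) (cancel (δ v k))
        where
        cancel : ∀ e → (e - e) - e * 0ℚ ≡ 0ℚ - 0ℚ
        cancel = solve-∀ ℚ-ring

      new-new-value : ∀ p → (p + ¼) - (p + - ¼) ≡ ½
      new-new-value = solve-∀ ℚ-ring

    -- A unit current from a new vertex to an old one leaves the K4 through v and puts the new
    -- vertices ½, ¼, ¼ above v; a unit current between two new vertices puts them at ±¼ from v.
    resistance-attachK4 : ∀ s t → resistance Y s t ≡ K4-resistances v r s t
    resistance-attachK4 (old i) (old j) = old-old i j
    resistance-attachK4 new₀    (old j) =
      trans (resistance-extend (potential X v j) ½ ¼ ¼ new₀ (old j) (new-old j) refl refl refl) (new-old-value j)
    resistance-attachK4 new₁    (old j) =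
      trans (resistance-extend (potential X v j) ¼ ½ ¼ new₁ (old j) (new-old j) refl refl refl) (new-old-value j)
    resistance-attachK4 new₂    (old j) =
      trans (resistance-extend (potential X v j) ¼ ¼ ½ new₂ (old j) (new-old j) refl refl refl) (new-old-value j)
    resistance-attachK4 (old i) new₀    = trans (resistance-sym Y (old i) new₀) (resistance-attachK4 new₀ (old i))
    resistance-attachK4 (old i) new₁    = trans (resistance-sym Y (old i) new₁) (resistance-attachK4 new₁ (old i))
    resistance-attachK4 (old i) new₂    = trans (resistance-sym Y (old i) new₂) (resistance-attachK4 new₂ (old i))
    resistance-attachK4 new₀    new₁    =
      trans (resistance-extend (potential X v v) ¼ (- ¼) 0ℚ new₀ new₁ new-new refl refl refl) (new-new-value (potential X v v v))
    resistance-attachK4 new₀    new₂    =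
      trans (resistance-extend (potential X v v) ¼ 0ℚ (- ¼) new₀ new₂ new-new refl refl refl) (new-new-value (potential X v v v))
    resistance-attachK4 new₁    new₂    =
      trans (resistance-extend (potential X v v) 0ℚ ¼ (- ¼) new₁ new₂ new-new refl refl refl) (new-new-value (potential X v v v))
    resistance-attachK4 new₁    new₀    = trans (resistance-sym Y new₁ new₀) (resistance-attachK4 new₀ new₁)
    resistance-attachK4 new₂    new₀    = trans (resistance-sym Y new₂ new₀) (resistance-attachK4 new₀ new₂)
    resistance-attachK4 new₂    new₁    = trans (resistance-sym Y new₂ new₁) (resistance-attachK4 new₁ new₂)
    resistance-attachK4 new₀    new₀    = resistance-self Y new₀
    resistance-attachK4 new₁    new₁    = resistance-self Y new₁
    resistance-attachK4 new₂    new₂    = resistance-self Y new₂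

handshake : ∀ {n} {A : Adj n} → IsSimple A → Σℕ n (deg A) ≡ 2 ℕ.* edges A
handshake {n} {A} (symmetric , irreflexive) = begin
  Σℕ n (deg A)
    ≡⟨ trans (Σℕ≡sum n (deg A)) (ℕΣ.sum-cong-≗ (λ i → Σℕ≡sum n (λ j → b2n (A i j)))) ⟩
  ℕΣ.sum (λ i → ℕΣ.sum (λ j → b2n (A i j)))              ≡⟨ ℕΣ.sum-cong-≗ (λ i → ℕΣ.sum-cong-≗ (split i)) ⟩
  ℕΣ.sum (λ i → ℕΣ.sum (λ j → B i j ℕ.+ B j i))          ≡⟨ ℕΣ.sum-cong-≗ (λ i → ℕΣ.∑-distrib-+ (B i) (λ j → B j i)) ⟩
  ℕΣ.sum (λ i → ℕΣ.sum (B i) ℕ.+ ℕΣ.sum (λ j → B j i))   ≡⟨ ℕΣ.∑-distrib-+ (λ i → ℕΣ.sum (B i)) _ ⟩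
  E ℕ.+ ℕΣ.sum (λ i → ℕΣ.sum (λ j → B j i))              ≡⟨ cong (E ℕ.+_) (ℕΣ.∑-comm B) ⟨
  E ℕ.+ E                                                ≡⟨ cong₂ ℕ._+_ edges≡E edges≡E ⟨
  edges A ℕ.+ edges A                                    ≡⟨ cong (edges A ℕ.+_) (ℕP.+-identityʳ (edges A)) ⟨
  2 ℕ.* edges A                                          ∎
  where
  B : Fin n → Fin n → ℕ
  B i j = b2n (does (i Fin.<? j) ∧ A i j)
  E = ℕΣ.sum (λ i → ℕΣ.sum (B i))
  edges≡E : edges A ≡ E
  edges≡E = trans (Σℕ≡sum n _) (ℕΣ.sum-cong-≗ (λ i → Σℕ≡sum n (B i)))
  split : ∀ i j → b2n (A i j) ≡ B i j ℕ.+ B j i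
  split i j with FinP.<-cmp i j
  ... | tri< i<j _ i≯j rewrite dec-true (i Fin.<? j) i<j | dec-false (j Fin.<? i) i≯j = sym (ℕP.+-identityʳ _)
  ... | tri> i≮j _ i>j rewrite dec-false (i Fin.<? j) i≮j | dec-true (j Fin.<? i) i>j = cong b2n (symmetric i j)
  ... | tri≈ i≮i refl _ rewrite dec-false (i Fin.<? i) i≮i | irreflexive i = refl

rescale : ∀ M a b c S μ → (ℕ→ℚ 4 * M) * a ≡ 1ℚ → (ℕ→ℚ 4 * (ℕ→ℚ 6 + M)) * b ≡ 1ℚ →
  (ℕ→ℚ 2 * M + ℕ→ℚ 12) * c ≡ 1ℚ →
  b * (((S + ℕ→ℚ 24 * μ) + ℕ→ℚ 9 * (ℕ→ℚ 2 * M)) + ℕ→ℚ 54)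
    ≡ ((((ℕ→ℚ 2 * M) * (a * S) + ℕ→ℚ 12 * μ) + ℕ→ℚ 9 * M) + ℕ→ℚ 27) * c
rescale M a b c S μ 4Ma≡1 4[6+M]b≡1 [2M+12]c≡1 = trans lhs (sym rhs)
  where
  T = ((S + ℕ→ℚ 24 * μ) + ℕ→ℚ 9 * (ℕ→ℚ 2 * M)) + ℕ→ℚ 54
  halve : ∀ M b c T → b * T * ((ℕ→ℚ 2 * M + ℕ→ℚ 12) * c) ≡ (ℕ→ℚ 4 * (ℕ→ℚ 6 + M)) * b * (½ * T * c)
  halve = solve-∀ ℚ-ring
  regroup : ∀ M a S μ c → ((((ℕ→ℚ 2 * M) * (a * S) + ℕ→ℚ 12 * μ) + ℕ→ℚ 9 * M) + ℕ→ℚ 27) * c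
                        ≡ (½ * ((ℕ→ℚ 4 * M) * a) * S + ℕ→ℚ 12 * μ + ℕ→ℚ 9 * M + ℕ→ℚ 27) * c
  regroup = solve-∀ ℚ-ring
  collect : ∀ M S μ c → (½ * 1ℚ * S + ℕ→ℚ 12 * μ + ℕ→ℚ 9 * M + ℕ→ℚ 27) * c
                      ≡ ½ * (((S + ℕ→ℚ 24 * μ) + ℕ→ℚ 9 * (ℕ→ℚ 2 * M)) + ℕ→ℚ 54) * c
  collect = solve-∀ ℚ-ring
  lhs : b * T ≡ ½ * T * c
  lhs = begin
    b * T                                          ≡⟨ ℚP.*-identityʳ (b * T) ⟨
    b * T * 1ℚ                                     ≡⟨ cong (b * T *_) [2M+12]c≡1 ⟨
    b * T * ((ℕ→ℚ 2 * M + ℕ→ℚ 12) * c)             ≡⟨ halve M b c T ⟩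
    (ℕ→ℚ 4 * (ℕ→ℚ 6 + M)) * b * (½ * T * c)        ≡⟨ cong (_* (½ * T * c)) 4[6+M]b≡1 ⟩
    1ℚ * (½ * T * c)                               ≡⟨ ℚP.*-identityˡ (½ * T * c) ⟩
    ½ * T * c                                      ∎
  rhs : ((((ℕ→ℚ 2 * M) * (a * S) + ℕ→ℚ 12 * μ) + ℕ→ℚ 9 * M) + ℕ→ℚ 27) * c ≡ ½ * T * c
  rhs = begin
    ((((ℕ→ℚ 2 * M) * (a * S) + ℕ→ℚ 12 * μ) + ℕ→ℚ 9 * M) + ℕ→ℚ 27) * c   ≡⟨ regroup M a S μ c ⟩
    (½ * ((ℕ→ℚ 4 * M) * a) * S + ℕ→ℚ 12 * μ + ℕ→ℚ 9 * M + ℕ→ℚ 27) * c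
      ≡⟨ cong (λ x → (½ * x * S + ℕ→ℚ 12 * μ + ℕ→ℚ 9 * M + ℕ→ℚ 27) * c) 4Ma≡1 ⟩
    (½ * 1ℚ * S + ℕ→ℚ 12 * μ + ℕ→ℚ 9 * M + ℕ→ℚ 27) * c                   ≡⟨ collect M S μ c ⟩
    ½ * T * c                                                            ∎

kemeny-rescale : ∀ m → 1 ≤ m → ∀ S μ →
  recipℕ (4 ℕ.* (6 ℕ.+ m)) * (((S + ℕ→ℚ 24 * μ) + ℕ→ℚ 9 * ℕ→ℚ (2 ℕ.* m)) + ℕ→ℚ 54)
    ≡ (((ℕ→ℚ (2 ℕ.* m) * (recipℕ (4 ℕ.* m) * S) + ℕ→ℚ 12 * μ) + ℕ→ℚ (9 ℕ.* m)) + ℕ→ℚ 27)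
      * recipℕ (2 ℕ.* m ℕ.+ 12)
kemeny-rescale m@(suc _) _ S μ = begin
  b * (((S + ℕ→ℚ 24 * μ) + ℕ→ℚ 9 * ℕ→ℚ (2 ℕ.* m)) + ℕ→ℚ 54)
    ≡⟨ cong (λ x → b * (((S + ℕ→ℚ 24 * μ) + ℕ→ℚ 9 * x) + ℕ→ℚ 54)) (ℕ→ℚ-* 2 m) ⟩
  b * (((S + ℕ→ℚ 24 * μ) + ℕ→ℚ 9 * (ℕ→ℚ 2 * M)) + ℕ→ℚ 54)
    ≡⟨ rescale M a b c S μ 4Ma≡1 4[6+M]b≡1 [2M+12]c≡1 ⟩
  ((((ℕ→ℚ 2 * M) * (a * S) + ℕ→ℚ 12 * μ) + ℕ→ℚ 9 * M) + ℕ→ℚ 27) * c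
    ≡⟨ cong₂ (λ x y → (((x * (a * S) + ℕ→ℚ 12 * μ) + y) + ℕ→ℚ 27) * c) (ℕ→ℚ-* 2 m) (ℕ→ℚ-* 9 m) ⟨
  (((ℕ→ℚ (2 ℕ.* m) * (a * S) + ℕ→ℚ 12 * μ) + ℕ→ℚ (9 ℕ.* m)) + ℕ→ℚ 27) * c ∎
  where
  M = ℕ→ℚ m
  a = recipℕ (4 ℕ.* m)
  b = recipℕ (4 ℕ.* (6 ℕ.+ m))
  c = recipℕ (2 ℕ.* m ℕ.+ 12)
  4Ma≡1 : (ℕ→ℚ 4 * M) * a ≡ 1ℚ
  4Ma≡1 = trans (cong (_* a) (sym (ℕ→ℚ-* 4 m))) (ℕ→ℚ*recipℕ (4 ℕ.* m))
  4[6+M]b≡1 : (ℕ→ℚ 4 * (ℕ→ℚ 6 + M)) * b ≡ 1ℚ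
  4[6+M]b≡1 = trans (cong (_* b) (sym (trans (ℕ→ℚ-* 4 (6 ℕ.+ m)) (cong (ℕ→ℚ 4 *_) (ℕ→ℚ-+ 6 m)))))
                    (ℕ→ℚ*recipℕ (4 ℕ.* (6 ℕ.+ m)))
  [2M+12]c≡1 : (ℕ→ℚ 2 * M + ℕ→ℚ 12) * c ≡ 1ℚ
  [2M+12]c≡1 = trans (cong (_* c) (sym (trans (ℕ→ℚ-+ (2 ℕ.* m) 12) (cong (_+ ℕ→ℚ 12) (ℕ→ℚ-* 2 m)))))
                     (ℕ→ℚ*recipℕ (2 ℕ.* m ℕ.+ 12))

lemma4p11 : (n : ℕ) (G : Adj n) → IsSimple G → Connected G → 1 ≤ edges G →
    (v : Fin n) (X : Matrix n) (Y : Matrix (suc (suc (suc n)))) →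
    IsMPInverse (laplacian G) X →
    IsMPInverse (laplacian (attachK4 G v)) Y →
    kemeny (attachK4 G v) Y ≡
      (((ℕ→ℚ (2 Data.Nat.* edges G) * kemeny G X + ℕ→ℚ 12 * moment G X v)
        + ℕ→ℚ (9 Data.Nat.* edges G)) + ℕ→ℚ 27)
      * recipℕ (2 Data.Nat.* edges G Data.Nat.+ 12)
lemma4p11 n G simple connected 1≤m v X Y X-mp Y-mp = begin
  kemeny G⁺ Y
    ≡⟨ cong₂ _*_ (cong (λ e → recipℕ (4 ℕ.* e)) edges-attachK4) (pairSum-cong deg-attachK4 resistance-attachK4) ⟩
  recipℕ (4 ℕ.* (6 ℕ.+ m)) * pairSum (K4-degrees v d) (K4-resistances v r)
    ≡⟨ cong (recipℕ (4 ℕ.* (6 ℕ.+ m)) *_) (pairSum-K4 v d r (resistance-sym X v) (resistance-self X v)) ⟩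
  recipℕ (4 ℕ.* (6 ℕ.+ m)) * (((pairSum d r + ℕ→ℚ 24 * μ) + ℕ→ℚ 9 * Σℚ n d) + ℕ→ℚ 54)
    ≡⟨ cong (λ D → recipℕ (4 ℕ.* (6 ℕ.+ m)) * (((pairSum d r + ℕ→ℚ 24 * μ) + ℕ→ℚ 9 * D) + ℕ→ℚ 54)) Σd≡2m ⟩
  recipℕ (4 ℕ.* (6 ℕ.+ m)) * (((pairSum d r + ℕ→ℚ 24 * μ) + ℕ→ℚ 9 * ℕ→ℚ (2 ℕ.* m)) + ℕ→ℚ 54)
    ≡⟨ kemeny-rescale m 1≤m (pairSum d r) μ ⟩
  (((ℕ→ℚ (2 ℕ.* m) * kemeny G X + ℕ→ℚ 12 * μ) + ℕ→ℚ (9 ℕ.* m)) + ℕ→ℚ 27) * recipℕ (2 ℕ.* m ℕ.+ 12) ∎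
  where
  open AttachK4 simple v
  open Resistances connected X-mp Y-mp
  m = edges G
  d = degℚ G
  r = resistance X
  μ = moment G X v
  Σd≡2m : Σℚ n d ≡ ℕ→ℚ (2 ℕ.* m)
  Σd≡2m = trans (sym (Σℕ→ℚ n (deg G))) (cong ℕ→ℚ (handshake simple))
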